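{- For every $n\geq 1$, $$B_{2n+2} = \{0\}\cup\{\phi(b)0 : b\in B_{2n+1}\},\qquad B_{2n+3} = \{0^{ -1}\phi(b) : b\in B_{2n+2}\},$$ and $B_3=\{1,11\}$.
   Context: Let $\phi$ be the morphism on $\{0,1\}^*$ with $\phi(0)=01$, $\phi(1)=0$. Finite Fibonacci words: $f_1=1$, $f_2=0$, $f_{n+2}=f_{n+1}f_n$. For $n\geq 3$, $p_n$ is $f_n$ with its last two letters deleted ($p_3=\epsilon$, $p_4=0$, $p_5=010$, ...). The minimal forbidden factors of the infinite Fibonacci word are $M_{2n+1}=1p_{2n+1}1$ and $M_{2n+2}=0p_{2n+2}0$ for $n\geq 1$ (so $M_3=11$, $M_4=000$, $M_5=10101$). A word $b$ is a border of $w$ if $w=xb=by$ for some words $x,y$. For $n\geq 3$, $B_n$ is the set of all nonempty borders of $M_n$. For a word $w$ beginning with $0$, $0^{ -1}w$ denotes $w$ with its first letter removed. -}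

module Defs where

open import Data.Nat using (ℕ; zero; suc; _∸_)
open import Data.List using (List; []; _∷_; _++_; take; length; concatMap)
open import Data.Product using (∃; _×_)
open import Relation.Binary.PropositionalEquality using (_≡_; _≢_)

data Letter : Set where
  𝟘 𝟙 : Letter

Word : Set
Word = List Letter

φ₀ : Letter → Word
φ₀ 𝟘 = 𝟘 ∷ 𝟙 ∷ []
φ₀ 𝟙 = 𝟘 ∷ []

φ : Word → Word
φ = concatMap φ₀

-- finite Fibonacci words f₁ = 1, f₂ = 0, f_{n+2} = f_{n+1} f_n  (f 0 is an unused dummy)
f : ℕ → Word
f zero = []
f (suc zero) = 𝟙 ∷ []
f (suc (suc zero)) = 𝟘 ∷ []
f (suc (suc (suc n))) = f (suc (suc n)) ++ f (suc n)

p : ℕ → Word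
p n = take (length (f n) ∸ 2) (f n)

frame : ℕ → Letter
frame zero = 𝟘
frame (suc zero) = 𝟙
frame (suc (suc n)) = frame n

-- minimal forbidden factors: M_{2n+1} = 1 p_{2n+1} 1, M_{2n+2} = 0 p_{2n+2} 0 (used for n ≥ 3)
M : ℕ → Word
M n = frame n ∷ (p n ++ frame n ∷ [])

IsBorder : Word → Word → Set
IsBorder b w = ∃ λ x → ∃ λ y → (w ≡ x ++ b) × (w ≡ b ++ y)

B : ℕ → Word → Set
B n w = (w ≢ []) × IsBorder w (M n)

-- φ carries M₂ₙ₊₁ to M₂ₙ₊₂ with its final 0 removed, and M₂ₙ₊₂ to 0 M₂ₙ₊₃. Borders travel
-- along φ because a φ-image can be parsed back uniquely, up to the single ambiguity that
-- φ(1) = 0 is a prefix of φ(0) = 01; the first and last letters of the words M n exclude it.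
module Submission where

open import Defs
open import Data.Nat using (ℕ; zero; suc; _≤_; _+_; _*_; s≤s)
open import Data.Nat.Properties using (m≤n+m; m+n∸n≡m; *-suc; +-comm)
open import Data.List using (List; []; _∷_; _++_; length; take)
open import Data.List.Properties
  using (∷-injectiveˡ; ∷-injectiveʳ; ∷ʳ-injectiveʳ; ++-assoc; ++-cancelˡ; ++-conicalʳ; length-++)
open import Data.Product using (∃; _×_; _,_; proj₁; proj₂)
open import Data.Sum using (_⊎_; inj₁; inj₂)
open import Data.Empty using (⊥-elim)
open import Function.Bundles using (_⇔_; mk⇔)
open import Relation.Binary.PropositionalEquality
open ≡-Reasoning

NonemptyBorder : Word → Word → Set
NonemptyBorder b w = (b ≢ []) × IsBorder b w

𝟘≢𝟙 : 𝟘 ≢ 𝟙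
𝟘≢𝟙 ()

snoc-suffix : ∀ xs x w {a : Letter} → xs ++ a ∷ [] ≡ x ++ w → w ≢ [] →
              ∃ λ w′ → w ≡ w′ ++ a ∷ [] × xs ≡ x ++ w′
snoc-suffix xs       []      w e _   = xs , sym e , refl
snoc-suffix []       (c ∷ x) w e w≢[] = ⊥-elim (w≢[] (++-conicalʳ x w (sym (∷-injectiveʳ e))))
snoc-suffix (d ∷ xs) (c ∷ x) w e w≢[] with snoc-suffix xs x w (∷-injectiveʳ e) w≢[]
... | w′ , w≡w′a , xs≡xw′ = w′ , w≡w′a , cong₂ _∷_ (∷-injectiveˡ e) xs≡xw′

snoc-prefix : ∀ m s y {c : Letter} → m ++ c ∷ [] ≡ s ++ y → length s ≤ length m →
              ∃ λ z → m ≡ s ++ z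
snoc-prefix m       []      y _ _         = m , refl
snoc-prefix []      (a ∷ s) y _ ()
snoc-prefix (d ∷ m) (a ∷ s) y e (s≤s s≤m) with snoc-prefix m s y (∷-injectiveʳ e) s≤m
... | z , m≡sz = z , cong₂ _∷_ (∷-injectiveˡ e) m≡sz

take-length-++ : ∀ {A : Set} (xs ys : List A) → take (length xs) (xs ++ ys) ≡ xs
take-length-++ []       ys = refl
take-length-++ (x ∷ xs) ys = cong (x ∷_) (take-length-++ xs ys)

φ-++ : ∀ u v → φ (u ++ v) ≡ φ u ++ φ v
φ-++ []      v = refl
φ-++ (𝟘 ∷ u) v = cong (λ t → 𝟘 ∷ 𝟙 ∷ t) (φ-++ u v)
φ-++ (𝟙 ∷ u) v = cong (𝟘 ∷_) (φ-++ u v)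

φ≢𝟙∷ : ∀ u {t} → φ u ≢ 𝟙 ∷ t
φ≢𝟙∷ []      ()
φ≢𝟙∷ (𝟘 ∷ u) ()
φ≢𝟙∷ (𝟙 ∷ u) ()

φ-++-𝟘∷ : ∀ u r → ∃ λ t → φ u ++ 𝟘 ∷ r ≡ 𝟘 ∷ t
φ-++-𝟘∷ []      r = r , refl
φ-++-𝟘∷ (𝟘 ∷ u) r = _ , refl
φ-++-𝟘∷ (𝟙 ∷ u) r = _ , refl

φ≡𝟘⇒≡𝟙 : ∀ u → φ u ≡ 𝟘 ∷ [] → u ≡ 𝟙 ∷ []
φ≡𝟘⇒≡𝟙 (𝟙 ∷ [])     _  = refl
φ≡𝟘⇒≡𝟙 (𝟙 ∷ 𝟘 ∷ u) ()
φ≡𝟘⇒≡𝟙 (𝟙 ∷ 𝟙 ∷ u) ()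

φ-suffix : ∀ m x v → φ m ≡ x ++ v →
           (∃ λ x′ → ∃ λ s → m ≡ x′ ++ s × v ≡ φ s)
         ⊎ (∃ λ x′ → ∃ λ s → m ≡ x′ ++ 𝟘 ∷ s × v ≡ 𝟙 ∷ φ s)
φ-suffix m       []          v e  = inj₁ ([] , m , refl , sym e)
φ-suffix []      (a ∷ x)     v ()
φ-suffix (𝟙 ∷ m) (a ∷ x)     v e with φ-suffix m x v (∷-injectiveʳ e)
... | inj₁ (x′ , s , m≡ , v≡) = inj₁ (𝟙 ∷ x′ , s , cong (𝟙 ∷_) m≡ , v≡)
... | inj₂ (x′ , s , m≡ , v≡) = inj₂ (𝟙 ∷ x′ , s , cong (𝟙 ∷_) m≡ , v≡)
φ-suffix (𝟘 ∷ m) (a ∷ [])    v e = inj₂ ([] , m , refl , sym (∷-injectiveʳ e))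
φ-suffix (𝟘 ∷ m) (a ∷ b ∷ x) v e with φ-suffix m x v (∷-injectiveʳ (∷-injectiveʳ e))
... | inj₁ (x′ , s , m≡ , v≡) = inj₁ (𝟘 ∷ x′ , s , cong (𝟘 ∷_) m≡ , v≡)
... | inj₂ (x′ , s , m≡ , v≡) = inj₂ (𝟘 ∷ x′ , s , cong (𝟘 ∷_) m≡ , v≡)

φ-prefix : ∀ m s y → φ m ≡ φ s ++ y →
           (∃ λ z → m ≡ s ++ z)
         ⊎ (∃ λ t → ∃ λ u → s ≡ t ++ 𝟙 ∷ [] × m ≡ t ++ 𝟘 ∷ u)
φ-prefix m       []      y _  = inj₁ (m , refl)
φ-prefix []      (𝟘 ∷ s) y ()
φ-prefix []      (𝟙 ∷ s) y ()
φ-prefix (𝟙 ∷ m) (𝟘 ∷ s) y e = ⊥-elim (φ≢𝟙∷ m (∷-injectiveʳ e))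
φ-prefix (𝟘 ∷ m) (𝟙 ∷ []) y _ = inj₂ ([] , m , refl , refl)
φ-prefix (𝟘 ∷ m) (𝟙 ∷ 𝟘 ∷ s) y ()
φ-prefix (𝟘 ∷ m) (𝟙 ∷ 𝟙 ∷ s) y ()
φ-prefix (𝟘 ∷ m) (𝟘 ∷ s) y e with φ-prefix m s y (∷-injectiveʳ (∷-injectiveʳ e))
... | inj₁ (z , m≡) = inj₁ (z , cong (𝟘 ∷_) m≡)
... | inj₂ (t , u , s≡ , m≡) = inj₂ (𝟘 ∷ t , u , cong (𝟘 ∷_) s≡ , cong (𝟘 ∷_) m≡)
φ-prefix (𝟙 ∷ m) (𝟙 ∷ s) y e with φ-prefix m s y (∷-injectiveʳ e)
... | inj₁ (z , m≡) = inj₁ (z , cong (𝟙 ∷_) m≡)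
... | inj₂ (t , u , s≡ , m≡) = inj₂ (𝟙 ∷ t , u , cong (𝟙 ∷_) s≡ , cong (𝟙 ∷_) m≡)

-- Appending 1 to m makes the hypothesis an equation between φ-images: φ (m ++ 1) = φ m ++ 0.
φ-∷ʳ𝟘-prefix : ∀ m s y → φ m ++ 𝟘 ∷ [] ≡ φ s ++ 𝟘 ∷ y → length s ≤ length m →
               ∃ λ z → m ≡ s ++ z
φ-∷ʳ𝟘-prefix m s y e s≤m with φ-prefix (m ++ 𝟙 ∷ []) s (𝟘 ∷ y) (trans (φ-++ m (𝟙 ∷ [])) e)
... | inj₁ (z , m𝟙≡sz) = snoc-prefix m s z m𝟙≡sz s≤m
... | inj₂ (t , u , refl , m𝟙≡t𝟘u) with ++-cancelˡ (φ t) _ _ (begin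
  φ t ++ 𝟘 ∷ 𝟙 ∷ φ u                 ≡⟨ sym (φ-++ t (𝟘 ∷ u)) ⟩
  φ (t ++ 𝟘 ∷ u)                     ≡⟨ cong φ (sym m𝟙≡t𝟘u) ⟩
  φ (m ++ 𝟙 ∷ [])                    ≡⟨ φ-++ m (𝟙 ∷ []) ⟩
  φ m ++ 𝟘 ∷ []                      ≡⟨ e ⟩
  φ (t ++ 𝟙 ∷ []) ++ 𝟘 ∷ y           ≡⟨ cong (_++ 𝟘 ∷ y) (φ-++ t (𝟙 ∷ [])) ⟩
  (φ t ++ 𝟘 ∷ []) ++ 𝟘 ∷ y           ≡⟨ ++-assoc (φ t) (𝟘 ∷ []) (𝟘 ∷ y) ⟩
  φ t ++ 𝟘 ∷ 𝟘 ∷ y                   ∎)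
... | ()

borders-φ∷ʳ𝟘 : ∀ m w → NonemptyBorder w (φ m ++ 𝟘 ∷ [])
                       ⇔ (w ≡ 𝟘 ∷ [] ⊎ ∃ λ b → NonemptyBorder b m × w ≡ φ b ++ 𝟘 ∷ [])
borders-φ∷ʳ𝟘 m w = mk⇔ to from
  where
  to : NonemptyBorder w (φ m ++ 𝟘 ∷ []) →
       w ≡ 𝟘 ∷ [] ⊎ ∃ λ b → NonemptyBorder b m × w ≡ φ b ++ 𝟘 ∷ []
  to (w≢[] , x , y , W≡xw , W≡wy) with snoc-suffix (φ m) x w W≡xw w≢[]
  ... | [] , w≡𝟘 , _ = inj₁ w≡𝟘
  ... | w′@(_ ∷ _) , w≡w′𝟘 , φm≡xw′ with φ-suffix m x w′ φm≡xw′
  ...   | inj₂ (_ , s , _ , w′≡𝟙φs) = ⊥-elim (𝟘≢𝟙 (∷-injectiveˡ (begin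
          𝟘 ∷ proj₁ (φ-++-𝟘∷ m [])     ≡⟨ sym (proj₂ (φ-++-𝟘∷ m [])) ⟩
          φ m ++ 𝟘 ∷ []                ≡⟨ W≡wy ⟩
          w ++ y                       ≡⟨ cong (_++ y) (trans w≡w′𝟘 (cong (_++ 𝟘 ∷ []) w′≡𝟙φs)) ⟩
          (𝟙 ∷ φ s ++ 𝟘 ∷ []) ++ y     ∎)))
  ...   | inj₁ (x′ , s , m≡x′s , w′≡φs) =
          inj₂ (s , (s≢[] , x′ , proj₁ s-prefix , m≡x′s , proj₂ s-prefix) , trans w≡w′𝟘 (cong (_++ 𝟘 ∷ []) w′≡φs))
    where
    s≢[] : s ≢ []
    s≢[] s≡[] with trans w′≡φs (cong φ s≡[])
    ... | ()
    s-prefix : ∃ λ z → m ≡ s ++ z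
    s-prefix = φ-∷ʳ𝟘-prefix m s y
      (begin
        φ m ++ 𝟘 ∷ []              ≡⟨ W≡wy ⟩
        w ++ y                     ≡⟨ cong (_++ y) (trans w≡w′𝟘 (cong (_++ 𝟘 ∷ []) w′≡φs)) ⟩
        (φ s ++ 𝟘 ∷ []) ++ y       ≡⟨ ++-assoc (φ s) (𝟘 ∷ []) y ⟩
        φ s ++ 𝟘 ∷ y               ∎)
      (subst (λ v → length s ≤ length v) (sym m≡x′s)
        (subst (length s ≤_) (sym (length-++ x′)) (m≤n+m (length s) (length x′))))

  from : w ≡ 𝟘 ∷ [] ⊎ (∃ λ b → NonemptyBorder b m × w ≡ φ b ++ 𝟘 ∷ []) →
         NonemptyBorder w (φ m ++ 𝟘 ∷ [])
  from (inj₁ refl) = (λ ()) , φ m , proj₁ (φ-++-𝟘∷ m []) , refl , proj₂ (φ-++-𝟘∷ m [])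
  from (inj₂ (b , (_ , x , y , m≡xb , m≡by) , refl)) with φ-++-𝟘∷ y []
  ... | t , φy𝟘≡𝟘t = φb𝟘≢[] , φ x , t , suffix , prefix
    where
    φb𝟘≢[] : φ b ++ 𝟘 ∷ [] ≢ []
    φb𝟘≢[] e with ++-conicalʳ (φ b) (𝟘 ∷ []) e
    ... | ()
    suffix : φ m ++ 𝟘 ∷ [] ≡ φ x ++ φ b ++ 𝟘 ∷ []
    suffix = begin
      φ m ++ 𝟘 ∷ []              ≡⟨ cong (λ v → φ v ++ 𝟘 ∷ []) m≡xb ⟩
      φ (x ++ b) ++ 𝟘 ∷ []       ≡⟨ cong (_++ 𝟘 ∷ []) (φ-++ x b) ⟩
      (φ x ++ φ b) ++ 𝟘 ∷ []     ≡⟨ ++-assoc (φ x) (φ b) (𝟘 ∷ []) ⟩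
      φ x ++ φ b ++ 𝟘 ∷ []       ∎
    prefix : φ m ++ 𝟘 ∷ [] ≡ (φ b ++ 𝟘 ∷ []) ++ t
    prefix = begin
      φ m ++ 𝟘 ∷ []              ≡⟨ cong (λ v → φ v ++ 𝟘 ∷ []) m≡by ⟩
      φ (b ++ y) ++ 𝟘 ∷ []       ≡⟨ cong (_++ 𝟘 ∷ []) (φ-++ b y) ⟩
      (φ b ++ φ y) ++ 𝟘 ∷ []     ≡⟨ ++-assoc (φ b) (φ y) (𝟘 ∷ []) ⟩
      φ b ++ φ y ++ 𝟘 ∷ []       ≡⟨ cong (φ b ++_) φy𝟘≡𝟘t ⟩
      φ b ++ 𝟘 ∷ t               ≡⟨ sym (++-assoc (φ b) (𝟘 ∷ []) t) ⟩
      (φ b ++ 𝟘 ∷ []) ++ t       ∎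

cons-suffix : ∀ u {a : Letter} {W w} → a ∷ W ≡ u ++ a ∷ w → ∃ λ X → W ≡ X ++ w
cons-suffix []      {a} e = [] , ∷-injectiveʳ e
cons-suffix (c ∷ u) {a} {W} {w} e = u ++ a ∷ [] , (begin
  W                    ≡⟨ ∷-injectiveʳ e ⟩
  u ++ a ∷ w           ≡⟨ sym (++-assoc u (a ∷ []) w) ⟩
  (u ++ a ∷ []) ++ w   ∎)

borders-𝟘⁻¹φ : ∀ q w → NonemptyBorder w (𝟙 ∷ φ (q ++ 𝟘 ∷ []))
                       ⇔ ∃ λ b → NonemptyBorder b (𝟘 ∷ q ++ 𝟘 ∷ []) × φ b ≡ 𝟘 ∷ w
borders-𝟘⁻¹φ q w = mk⇔ (to w) from
  where
  m W : Word
  m = 𝟘 ∷ q ++ 𝟘 ∷ []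
  W = 𝟙 ∷ φ (q ++ 𝟘 ∷ [])

  m≢∷ʳ𝟙 : ∀ x → m ≢ x ++ 𝟙 ∷ []
  m≢∷ʳ𝟙 x e = 𝟘≢𝟙 (∷ʳ-injectiveʳ (𝟘 ∷ q) x e)

  to : ∀ w → NonemptyBorder w W → ∃ λ b → NonemptyBorder b m × φ b ≡ 𝟘 ∷ w
  to []      (w≢[] , _) = ⊥-elim (w≢[] refl)
  to (a ∷ w) (_ , x , y , W≡xw , W≡wy) with φ-suffix m (𝟘 ∷ x) (a ∷ w) (cong (𝟘 ∷_) W≡xw)
  ... | inj₁ (_ , s , _ , aw≡φs) =
        ⊥-elim (φ≢𝟙∷ s (trans (sym aw≡φs) (cong (_∷ w) (sym (∷-injectiveˡ W≡wy)))))
  ... | inj₂ (x′ , s , m≡x′𝟘s , aw≡𝟙φs) =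
        𝟘 ∷ s , ((λ ()) , x′ , proj₁ 𝟘s-prefix , m≡x′𝟘s , proj₂ 𝟘s-prefix) , cong (𝟘 ∷_) (sym aw≡𝟙φs)
    where
    𝟘s-prefix : ∃ λ z → m ≡ 𝟘 ∷ s ++ z
    𝟘s-prefix with φ-prefix m (𝟘 ∷ s) y (cong (𝟘 ∷_) (trans W≡wy (cong (_++ y) aw≡𝟙φs)))
    ... | inj₁ prefix = prefix
    ... | inj₂ (t , _ , 𝟘s≡t𝟙 , _) = ⊥-elim (m≢∷ʳ𝟙 (x′ ++ t) (begin
          m                          ≡⟨ m≡x′𝟘s ⟩
          x′ ++ 𝟘 ∷ s                ≡⟨ cong (x′ ++_) 𝟘s≡t𝟙 ⟩
          x′ ++ t ++ 𝟙 ∷ []          ≡⟨ sym (++-assoc x′ t (𝟙 ∷ [])) ⟩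
          (x′ ++ t) ++ 𝟙 ∷ []        ∎))

  from : (∃ λ b → NonemptyBorder b m × φ b ≡ 𝟘 ∷ w) → NonemptyBorder w W
  from (b , (_ , x , y , m≡xb , m≡by) , φb≡𝟘w) =
    w≢[] , proj₁ w-suffix , φ y , proj₂ w-suffix , ∷-injectiveʳ w-prefix
    where
    w≢[] : w ≢ []
    w≢[] refl = m≢∷ʳ𝟙 x (trans m≡xb (cong (x ++_) (φ≡𝟘⇒≡𝟙 b φb≡𝟘w)))
    w-suffix : ∃ λ X → W ≡ X ++ w
    w-suffix = cons-suffix (φ x) (begin
      φ m                  ≡⟨ cong φ m≡xb ⟩
      φ (x ++ b)           ≡⟨ φ-++ x b ⟩
      φ x ++ φ b           ≡⟨ cong (φ x ++_) φb≡𝟘w ⟩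
      φ x ++ 𝟘 ∷ w         ∎)
    w-prefix : φ m ≡ 𝟘 ∷ w ++ φ y
    w-prefix = begin
      φ m                  ≡⟨ cong φ m≡by ⟩
      φ (b ++ y)           ≡⟨ φ-++ b y ⟩
      φ b ++ φ y           ≡⟨ cong (_++ φ y) φb≡𝟘w ⟩
      𝟘 ∷ w ++ φ y         ∎

φ-f : ∀ n → φ (f (suc n)) ≡ f (suc (suc n))
φ-f zero          = refl
φ-f (suc zero)    = refl
φ-f (suc (suc n)) = trans (φ-++ (f (suc (suc n))) (f (suc n))) (cong₂ _++_ (φ-f (suc n)) (φ-f n))

f-suc-ending : ∀ n P {a b} → f (suc n) ≡ P ++ a ∷ b ∷ [] → f (suc (suc n)) ≡ φ P ++ φ (a ∷ b ∷ [])
f-suc-ending n P {a} {b} e = begin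
  f (suc (suc n))          ≡⟨ sym (φ-f n) ⟩
  φ (f (suc n))            ≡⟨ cong φ e ⟩
  φ (P ++ a ∷ b ∷ [])      ≡⟨ φ-++ P (a ∷ b ∷ []) ⟩
  φ P ++ φ (a ∷ b ∷ [])    ∎

frame-suc-𝟘 : ∀ n → frame n ≡ 𝟘 → frame (suc n) ≡ 𝟙
frame-suc-𝟘 zero          _ = refl
frame-suc-𝟘 (suc zero)    ()
frame-suc-𝟘 (suc (suc n)) e = frame-suc-𝟘 n e

φ-frames : ∀ n → φ (frame n ∷ frame (suc n) ∷ []) ≡ 𝟘 ∷ frame (suc n) ∷ frame n ∷ []
φ-frames zero          = refl
φ-frames (suc zero)    = refl
φ-frames (suc (suc n)) = φ-frames n

f-ending : ∀ n → ∃ λ P → f (3 + n) ≡ P ++ frame n ∷ frame (suc n) ∷ []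
f-ending zero    = [] , refl
f-ending (suc n) with f-ending n
... | P , e = φ P ++ 𝟘 ∷ [] , (begin
  f (4 + n)                                           ≡⟨ f-suc-ending (2 + n) P e ⟩
  φ P ++ φ (frame n ∷ frame (suc n) ∷ [])             ≡⟨ cong (φ P ++_) (φ-frames n) ⟩
  φ P ++ 𝟘 ∷ frame (suc n) ∷ frame n ∷ []             ≡⟨ sym (++-assoc (φ P) (𝟘 ∷ []) _) ⟩
  (φ P ++ 𝟘 ∷ []) ++ frame (suc n) ∷ frame n ∷ []     ∎)

p-of-ending : ∀ n P {a b} → f n ≡ P ++ a ∷ b ∷ [] → p n ≡ P
p-of-ending n P {a} {b} e rewrite e | length-++ P {a ∷ b ∷ []} | m+n∸n≡m (length P) 2 =
  take-length-++ P (a ∷ b ∷ [])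

M-of-ending : ∀ n P {a b c} → f n ≡ P ++ a ∷ b ∷ [] → frame n ≡ c → M n ≡ c ∷ P ++ c ∷ []
M-of-ending n P e refl = cong (λ r → frame n ∷ r ++ frame n ∷ []) (p-of-ending n P e)

M-even≡φ-M-odd∷ʳ𝟘 : ∀ m → frame m ≡ 𝟘 → M (4 + m) ≡ φ (M (3 + m)) ++ 𝟘 ∷ []
M-even≡φ-M-odd∷ʳ𝟘 m frame-m with f-ending m
... | P , e = begin
  M (4 + m)                         ≡⟨ M-of-ending (4 + m) (φ P ++ 𝟘 ∷ []) f₄ frame-m ⟩
  𝟘 ∷ (φ P ++ 𝟘 ∷ []) ++ 𝟘 ∷ []     ≡⟨ cong (λ v → 𝟘 ∷ v ++ 𝟘 ∷ []) (sym (φ-++ P (𝟙 ∷ []))) ⟩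
  φ (𝟙 ∷ P ++ 𝟙 ∷ []) ++ 𝟘 ∷ []     ≡⟨ cong (λ v → φ v ++ 𝟘 ∷ []) (sym (M-of-ending (3 + m) P f₃ frame-3+m)) ⟩
  φ (M (3 + m)) ++ 𝟘 ∷ []           ∎
  where
  frame-3+m : frame (3 + m) ≡ 𝟙
  frame-3+m = frame-suc-𝟘 m frame-m
  f₃ : f (3 + m) ≡ P ++ 𝟘 ∷ 𝟙 ∷ []
  f₃ = subst₂ (λ a b → f (3 + m) ≡ P ++ a ∷ b ∷ []) frame-m frame-3+m e
  f₄ : f (4 + m) ≡ (φ P ++ 𝟘 ∷ []) ++ 𝟙 ∷ 𝟘 ∷ []
  f₄ = trans (f-suc-ending (2 + m) P f₃) (sym (++-assoc (φ P) (𝟘 ∷ []) (𝟙 ∷ 𝟘 ∷ [])))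

M-odd≡𝟘⁻¹φ-M-even : ∀ m → frame m ≡ 𝟘 → M (5 + m) ≡ 𝟙 ∷ φ (p (4 + m) ++ 𝟘 ∷ [])
M-odd≡𝟘⁻¹φ-M-even m frame-m with f-ending (suc m)
... | P , e = begin
  M (5 + m)                         ≡⟨ M-of-ending (5 + m) (φ P ++ 𝟘 ∷ []) f₅ frame-3+m ⟩
  𝟙 ∷ (φ P ++ 𝟘 ∷ []) ++ 𝟙 ∷ []     ≡⟨ cong (𝟙 ∷_) (++-assoc (φ P) (𝟘 ∷ []) (𝟙 ∷ [])) ⟩
  𝟙 ∷ φ P ++ φ (𝟘 ∷ [])             ≡⟨ cong (𝟙 ∷_) (sym (φ-++ P (𝟘 ∷ []))) ⟩
  𝟙 ∷ φ (P ++ 𝟘 ∷ [])               ≡⟨ cong (λ v → 𝟙 ∷ φ (v ++ 𝟘 ∷ [])) (sym (p-of-ending (4 + m) P f₄)) ⟩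
  𝟙 ∷ φ (p (4 + m) ++ 𝟘 ∷ [])       ∎
  where
  frame-3+m : frame (3 + m) ≡ 𝟙
  frame-3+m = frame-suc-𝟘 m frame-m
  f₄ : f (4 + m) ≡ P ++ 𝟙 ∷ 𝟘 ∷ []
  f₄ = subst₂ (λ a b → f (4 + m) ≡ P ++ a ∷ b ∷ []) frame-3+m frame-m e
  f₅ : f (5 + m) ≡ (φ P ++ 𝟘 ∷ []) ++ 𝟘 ∷ 𝟙 ∷ []
  f₅ = trans (f-suc-ending (3 + m) P f₄) (sym (++-assoc (φ P) (𝟘 ∷ []) (𝟘 ∷ 𝟙 ∷ [])))

-- frame m ≡ 𝟘 says that m is even, i.e. 3 + m is odd.
borders-step : ∀ m → frame m ≡ 𝟘 →
  (∀ w → B (4 + m) w ⇔ (w ≡ 𝟘 ∷ [] ⊎ ∃ λ b → B (3 + m) b × w ≡ φ b ++ 𝟘 ∷ []))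
  × (∀ w → B (5 + m) w ⇔ ∃ λ b → B (4 + m) b × φ b ≡ 𝟘 ∷ w)
borders-step m frame-m =
  subst (λ W → ∀ w → NonemptyBorder w W
                       ⇔ (w ≡ 𝟘 ∷ [] ⊎ ∃ λ b → NonemptyBorder b (M (3 + m)) × w ≡ φ b ++ 𝟘 ∷ []))
        (sym (M-even≡φ-M-odd∷ʳ𝟘 m frame-m)) (borders-φ∷ʳ𝟘 (M (3 + m))) ,
  subst₂ (λ W V → ∀ w → NonemptyBorder w W ⇔ ∃ λ b → NonemptyBorder b V × φ b ≡ 𝟘 ∷ w)
         (sym (M-odd≡𝟘⁻¹φ-M-even m frame-m)) (sym M₄₊ₘ-shape) (borders-𝟘⁻¹φ (p (4 + m)))
  where
  M₄₊ₘ-shape : M (4 + m) ≡ 𝟘 ∷ p (4 + m) ++ 𝟘 ∷ []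
  M₄₊ₘ-shape = cong (λ c → c ∷ p (4 + m) ++ c ∷ []) frame-m

frame-2* : ∀ k → frame (2 * k) ≡ 𝟘
frame-2* zero = refl
frame-2* (suc k) = trans (cong frame (*-suc 2 k)) (frame-2* k)

2*suc+ : ∀ k j → 2 * suc k + j ≡ (2 + j) + 2 * k
2*suc+ k j = trans (cong (_+ j) (*-suc 2 k)) (cong (2 +_) (+-comm (2 * k) j))

borders-recurrence : (n : ℕ) → 1 ≤ n →
  ((w : Word) → B (2 * n + 2) w ⇔ ((w ≡ 𝟘 ∷ []) ⊎ (∃ λ b → B (2 * n + 1) b × (w ≡ φ b ++ 𝟘 ∷ []))))
  × ((w : Word) → B (2 * n + 3) w ⇔ (∃ λ b → B (2 * n + 2) b × (φ b ≡ 𝟘 ∷ w)))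
borders-recurrence (suc k) _ rewrite 2*suc+ k 1 | 2*suc+ k 2 | 2*suc+ k 3 = borders-step (2 * k) (frame-2* k)

borders-M₃ : (w : Word) → B 3 w ⇔ ((w ≡ 𝟙 ∷ []) ⊎ (w ≡ 𝟙 ∷ 𝟙 ∷ []))
borders-M₃ w = mk⇔ to from
  where
  to : B 3 w → (w ≡ 𝟙 ∷ []) ⊎ (w ≡ 𝟙 ∷ 𝟙 ∷ [])
  to (_    , []          , _ , e , _) = inj₂ (sym e)
  to (_    , _ ∷ []      , _ , e , _) = inj₁ (sym (∷-injectiveʳ e))
  to (w≢[] , _ ∷ _ ∷ x , _ , e , _) = ⊥-elim (w≢[] (++-conicalʳ x w (sym (∷-injectiveʳ (∷-injectiveʳ e)))))
  from : (w ≡ 𝟙 ∷ []) ⊎ (w ≡ 𝟙 ∷ 𝟙 ∷ []) → B 3 w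
  from (inj₁ refl) = (λ ()) , 𝟙 ∷ [] , 𝟙 ∷ [] , refl , refl
  from (inj₂ refl) = (λ ()) , [] , [] , refl , refl

theorem2 : ((n : ℕ) → 1 ≤ n →
             ((w : Word) → B (2 * n + 2) w ⇔ ((w ≡ 𝟘 ∷ []) ⊎ (∃ λ b → B (2 * n + 1) b × (w ≡ φ b ++ 𝟘 ∷ []))))
             × ((w : Word) → B (2 * n + 3) w ⇔ (∃ λ b → B (2 * n + 2) b × (φ b ≡ 𝟘 ∷ w))))
           × ((w : Word) → B 3 w ⇔ ((w ≡ 𝟙 ∷ []) ⊎ (w ≡ 𝟙 ∷ 𝟙 ∷ [])))
theorem2 = borders-recurrence , borders-M₃
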